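{- Let $G$ be a looped simple graph and let $S,T\subseteq W(G)$ be disjoint transversals, i.e. $S\cap T=\varnothing$ and $|S\cap\{v_\phi,v_\chi,v_\psi\}|=1=|T\cap\{v_\phi,v_\chi,v_\psi\}|$ for all $v\in V(G)$. For each $v\in V(G)$ let $v_S$ and $v_T$ be the elements of $S\cap\{v_\phi,v_\chi,v_\psi\}$ and $T\cap\{v_\phi,v_\chi,v_\psi\}$ respectively. Then the function $v_S\mapsto v_T$ defines a strong map from $M(IAS(G))|S$ to $(M(IAS(G))|T)^*$.
   Context: A looped simple graph is a finite graph in which each vertex may carry at most one loop and distinct non-loop edges join distinct pairs of vertices. $A(G)$ is the adjacency matrix over $GF(2)$ (diagonal $1$ iff looped). $M(IAS(G))$ is the binary matroid represented by the columns of $(I\mid A(G)\mid I+A(G))$; its ground set $W(G)$ consists of columns $v_\phi,v_\chi,v_\psi$ for $v\in V(G)$, the columns of $v$ in $I$, $A(G)$, $I+A(G)$. $M|X$ is the restriction of $M$ to $X$ and $M^*$ the dual matroid. A map $\sigma$ from the ground set of a matroid $M$ to that of a matroid $N$ is a strong map if the preimage of every flat of $N$ is a flat of $M$ (equivalently, $\sigma$ maps closures into closures: if $x$ is in the closure of $A$ in $M$ then $\sigma(x)$ is in the closure of $\sigma(A)$ in $N$). -}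

module Defs where

open import Data.Nat using (ℕ)
open import Data.Fin using (Fin) renaming (_≟_ to _≟ᶠ_)
open import Data.Bool using (Bool; true; false; _∧_; _∨_; _xor_; not)
open import Data.Product using (Σ; ∃; _×_; _,_)
open import Data.Empty using (⊥)
open import Relation.Nullary using (¬_; Dec; yes; no)
open import Relation.Nullary.Decidable using (⌊_⌋)
open import Relation.Binary.PropositionalEquality using (_≡_; refl)
import Data.Vec.Functional as VF
import Data.Sum

Subset : Set → Set
Subset E = E → Bool

_∈_ : {E : Set} → E → Subset E → Set
x ∈ X = X x ≡ true

_∉_ : {E : Set} → E → Subset E → Set
x ∉ X = X x ≡ false

_⊆_ : {E : Set} → Subset E → Subset E → Set
X ⊆ Y = ∀ x → x ∈ X → x ∈ Y

insert : {E : Set} → ((a b : E) → Dec (a ≡ b)) → E → Subset E → Subset E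
insert eq x Y y = Y y ∨ ⌊ eq y x ⌋

record Matroid (E : Set) : Set₁ where
  field
    ground : Subset E
    Ind    : Subset E → Set
open Matroid public

module _ {E : Set} (eq : (a b : E) → Dec (a ≡ b)) where

  -- x ∈ cl(A)  iff  x ∈ A, or some independent I ⊆ A has I ∪ {x} dependent
  -- (i.e. r(A ∪ x) = r(A)).
  InClosure : Matroid E → Subset E → E → Set
  InClosure M A x = Data.Sum._⊎_ (x ∈ A)
    (Σ (Subset E) λ I → I ⊆ A × Ind M I × ¬ Ind M (insert eq x I))

  Flat : Matroid E → Subset E → Set
  Flat M F = F ⊆ ground M × (∀ x → x ∈ ground M → InClosure M F x → x ∈ F)

  IsBasis : Matroid E → Subset E → Set
  IsBasis M B = B ⊆ ground M × Ind M B
              × (∀ x → x ∈ ground M → x ∉ B → ¬ Ind M (insert eq x B))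

-- Restriction M|X (X ⊆ ground M is assumed by the caller).
_∣_ : {E : Set} → Matroid E → Subset E → Matroid E
M ∣ X = record { ground = X ; Ind = λ Y → Y ⊆ X × Ind M Y }

dual : {E : Set} → ((a b : E) → Dec (a ≡ b)) → Matroid E → Matroid E
dual {E} eq M = record
  { ground = ground M
  ; Ind    = λ Y → Y ⊆ ground M
                 × Σ (Subset E) λ B → IsBasis eq M B × (∀ x → x ∈ Y → x ∉ B) }

-- Looped simple graphs on vertex set Fin n: a symmetric GF(2) adjacency
-- matrix (diagonal entry true iff the vertex is looped).

record LoopedSimpleGraph (n : ℕ) : Set where
  field
    adj  : Fin n → Fin n → Bool
    symm : ∀ i j → adj i j ≡ adj j i
open LoopedSimpleGraph public

data Tag : Set where
  φ χ ψ : Tag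

_≟ᵗ_ : (a b : Tag) → Dec (a ≡ b)
φ ≟ᵗ φ = yes refl
φ ≟ᵗ χ = no λ ()
φ ≟ᵗ ψ = no λ ()
χ ≟ᵗ φ = no λ ()
χ ≟ᵗ χ = yes refl
χ ≟ᵗ ψ = no λ ()
ψ ≟ᵗ φ = no λ ()
ψ ≟ᵗ χ = no λ ()
ψ ≟ᵗ ψ = yes refl

W : ℕ → Set
W n = Fin n × Tag

_≟W_ : {n : ℕ} → (a b : W n) → Dec (a ≡ b)
(v , s) ≟W (w , t) with v ≟ᶠ w | s ≟ᵗ t
... | yes refl | yes refl = yes refl
... | no v≢w   | _        = no λ { refl → v≢w refl }
... | yes _    | no s≢t   = no λ { refl → s≢t refl }

δ : {n : ℕ} → Fin n → Fin n → Bool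
δ i v = ⌊ i ≟ᶠ v ⌋

-- columns of (I | A(G) | I + A(G)) over GF(2)
column : {n : ℕ} → LoopedSimpleGraph n → W n → Fin n → Bool
column G (v , φ) i = δ i v
column G (v , χ) i = adj G i v
column G (v , ψ) i = δ i v xor adj G i v

sumW : {n : ℕ} → (W n → Bool) → Bool
sumW f = VF.foldr _xor_ false (λ v → f (v , φ) xor (f (v , χ) xor f (v , ψ)))

LinIndep : {n : ℕ} → LoopedSimpleGraph n → Subset (W n) → Set
LinIndep G Y = ∀ Z → Z ⊆ Y
             → (∀ i → sumW (λ w → Z w ∧ column G w i) ≡ false)
             → ∀ w → w ∉ Z

MIAS : {n : ℕ} → LoopedSimpleGraph n → Matroid (W n)
MIAS G = record { ground = λ _ → true ; Ind = LinIndep G }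

IsTransversal : {n : ℕ} → Subset (W n) → Set
IsTransversal {n} X = ∀ (v : Fin n) → Σ Tag λ a → (v , a) ∈ X × (∀ b → (v , b) ∈ X → b ≡ a)

Disjoint : {E : Set} → Subset E → Subset E → Set
Disjoint X Y = ∀ x → x ∈ X → x ∉ Y

preimageST : {n : ℕ} → Subset (W n) → Subset (W n) → Subset (W n) → Subset (W n)
preimageST S T F (v , a) =
  S (v , a) ∧ ((T (v , φ) ∧ F (v , φ)) ∨ ((T (v , χ) ∧ F (v , χ)) ∨ (T (v , ψ) ∧ F (v , ψ))))

-- A set Z of columns of (I | A | I + A) summing to zero (a cycle) determines at each vertex v the
-- coefficients (a_v , b_v) ∈ GF(2)² of Z on e_v and on A e_v, and being a cycle means a = A b. For
-- two cycles Z, Z' the sum over v of the symplectic products b'_v a_v + b_v a'_v is therefore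
-- b'ᵀ A b + bᵀ A b' = 0, since A is symmetric. The tags φ, χ, ψ give the three nonzero vectors of
-- GF(2)², any two distinct of which have product 1; so for cycles Z ⊆ S and Z' ⊆ T the number of
-- vertices v with v_S ∈ Z and v_T ∈ Z' is even.
--
-- Now let v_S be in the closure of the preimage of a flat F of (M|T)*, witnessed by an independent
-- I, and suppose v_T ∉ F. Some cycle Z ⊆ I + v_S contains v_S. As v_T is not in the closure of F in
-- (M|T)*, it is spanned by T ∖ F ∖ v_T (otherwise a basis of M|T grown greedily from a basis of
-- T ∖ F ∖ v_T and v_T shows that it is), so some cycle Z' ⊆ T ∖ F contains v_T. For any other
-- vertex u with u_S ∈ Z we have u_S ∈ I, so u_T ∈ F and u_T ∉ Z': Z and Z' meet at v only.
-- Membership in F is decidable, so the classical existence of bases costs only double negations.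

module Submission where

open import Defs
open import Algebra.Bundles using (CommutativeMonoid; CommutativeRing)
open import Data.Bool using (Bool; true; false; _∧_; _∨_; _xor_; not)
  renaming (_≟_ to _≟ᵇ_)
open import Data.Bool.Properties
  using ( xor-∧-commutativeRing; xor-identityʳ; xor-same; ∧-distribˡ-xor; ∧-distribʳ-xor
        ; ∧-comm; ∧-assoc; ∧-identityʳ; ∧-zeroʳ; ∨-zeroʳ; ¬-not )
open import Data.Fin using (Fin; zero; suc; punchIn) renaming (_≟_ to _≟ᶠ_)
open import Data.Fin.Properties using (punchInᵢ≢i)
open import Data.List using (List; []; _∷_; allFin; cartesianProduct)
open import Data.List.Membership.Propositional using () renaming (_∈_ to _∈ₗ_)
open import Data.List.Membership.Propositional.Properties using (∈-allFin; ∈-cartesianProduct⁺)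
open import Data.List.Relation.Unary.Any using (here; there)
open import Data.Maybe using (nothing)
open import Data.Nat using (ℕ; suc)
open import Data.Product using (Σ; ∃; _×_; _,_; proj₁; proj₂)
open import Data.Sum using (_⊎_; inj₁; inj₂; [_,_]; [_,_]′)
open import Data.Empty using (⊥; ⊥-elim)
open import Function using (_∘_; case_of_)
open import Relation.Binary.Definitions using (DecidableEquality)
open import Relation.Binary.PropositionalEquality
  using (_≡_; _≢_; _≗_; refl; sym; trans; cong; cong₂; subst; module ≡-Reasoning)
open import Relation.Nullary using (¬_; Dec; yes; no)
open import Relation.Nullary.Decidable using (⌊_⌋; ¬¬-excluded-middle)
open import Effect.Monad using (RawMonad)
open import Level using (0ℓ)
open import Relation.Nullary.Negation using (¬¬-Monad)
open RawMonad (¬¬-Monad {a = 0ℓ}) using (pure; _<$>_; _>>=_)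
open import Tactic.RingSolver using (solve-∀)
open import Tactic.RingSolver.Core.AlmostCommutativeRing using (AlmostCommutativeRing; fromCommutativeRing)

open CommutativeRing xor-∧-commutativeRing using (semiring; +-commutativeMonoid)
open import Algebra.Properties.CommutativeSemigroup
  (CommutativeMonoid.commutativeSemigroup +-commutativeMonoid) renaming (interchange to xor-interchange)
open import Algebra.Properties.Semiring.Sum semiring
  using (sum; sum-cong-≗; sum-replicate-zero; sum-remove; ∑-distrib-+; ∑-comm; *-distribˡ-sum)

GF₂ : AlmostCommutativeRing 0ℓ 0ℓ
GF₂ = fromCommutativeRing xor-∧-commutativeRing (λ _ → nothing)

∧-true⁻ : ∀ x {y} → x ∧ y ≡ true → x ≡ true × y ≡ true
∧-true⁻ true p = refl , p

∨-true⁻ : ∀ x {y} → x ∨ y ≡ true → x ≡ true ⊎ y ≡ true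
∨-true⁻ true  _ = inj₁ refl
∨-true⁻ false p = inj₂ p

xor-true⁻ : ∀ x {y} → x xor y ≡ true → x ≡ true ⊎ y ≡ true
xor-true⁻ true  _ = inj₁ refl
xor-true⁻ false p = inj₂ p

∧-cong-when : ∀ b {x y} → (b ≡ true → x ≡ y) → b ∧ x ≡ b ∧ y
∧-cong-when true  x≡y = x≡y refl
∧-cong-when false _   = refl

xor-false⇒≡ : ∀ x y → x xor y ≡ false → x ≡ y
xor-false⇒≡ true  true  _ = refl
xor-false⇒≡ false false _ = refl

module _ {E : Set} where

  private variable
    x e : E
    X Y : Subset E

  ∅ : Subset E
  ∅ _ = false

  infixl 30 _∖_ _⊕_

  _∖_ _⊕_ : Subset E → Subset E → Subset E
  (X ∖ Y) x = X x ∧ not (Y x)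
  (X ⊕ Y) x = X x xor Y x

  _∈?_ : (x : E) (X : Subset E) → Dec (x ∈ X)
  x ∈? X = X x ≟ᵇ true

  ∈⇒¬∉ : x ∈ X → ¬ x ∉ X
  ∈⇒¬∉ p q with () ← trans (sym p) q

  ¬∈⇒∉ : ¬ x ∈ X → x ∉ X
  ¬∈⇒∉ = ¬-not {y = true}

  ∈-∖⁺ : x ∈ X → x ∉ Y → x ∈ X ∖ Y
  ∈-∖⁺ p q = cong₂ _∧_ p (cong not q)

  ∈-∖⁻ : x ∈ X ∖ Y → x ∈ X × x ∉ Y
  ∈-∖⁻ {x} {X} {Y} p with X x | Y x | p
  ... | true | false | _ = refl , refl

  ∉-∖⁻ : x ∈ X → x ∉ X ∖ Y → x ∈ Y
  ∉-∖⁻ {x} {X} {Y} p q with X x | Y x | p | q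
  ... | true | true | _ | _ = refl

  ∈-⊕⁻ : x ∈ X ⊕ Y → x ∈ X ⊎ x ∈ Y
  ∈-⊕⁻ {x} {X} = xor-true⁻ (X x)

module _ {E : Set} (_≟_ : DecidableEquality E) where

  private variable
    x e : E
    X Y : Subset E

  single : E → Subset E
  single e x = ⌊ x ≟ e ⌋

  ∈-single : ∀ e → e ∈ single e
  ∈-single e with e ≟ e
  ... | yes _ = refl
  ... | no e≢e = ⊥-elim (e≢e refl)

  ∈-single⁻ : x ∈ single e → x ≡ e
  ∈-single⁻ {x} {e} p with x ≟ e | p
  ... | yes x≡e | _ = x≡e

  ∉-single : x ≢ e → x ∉ single e
  ∉-single {e = e} x≢e = ¬∈⇒∉ {X = single e} (x≢e ∘ ∈-single⁻)

  ∈-insert⁻ : x ∈ insert _≟_ e X → x ∈ X ⊎ x ≡ e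
  ∈-insert⁻ {x} {e} {X} p with ∨-true⁻ (X x) p
  ... | inj₁ x∈X = inj₁ x∈X
  ... | inj₂ x∈e = inj₂ (∈-single⁻ x∈e)

  ∈-insert⁺ˡ : x ∈ X → x ∈ insert _≟_ e X
  ∈-insert⁺ˡ p = cong (_∨ _) p

  ∈-insert⁺ʳ : e ∈ insert _≟_ e X
  ∈-insert⁺ʳ {e} {X} = trans (cong (X e ∨_) (∈-single e)) (∨-zeroʳ (X e))

  ∉-∖-single : x ∉ X ∖ single x
  ∉-∖-single {x} {X} = ¬∈⇒∉ {X = X ∖ single x} λ x∈ →
    ∈⇒¬∉ {X = single x} (∈-single x) (proj₂ (∈-∖⁻ {X = X} {Y = single x} x∈))

  insert-⊆ : e ∈ Y → X ⊆ Y → insert _≟_ e X ⊆ Y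
  insert-⊆ {X = X} e∈Y X⊆Y x p with ∈-insert⁻ {X = X} p
  ... | inj₁ x∈X = X⊆Y x x∈X
  ... | inj₂ refl = e∈Y

sum-zero : ∀ {m} {f : Fin m → Bool} → (∀ i → f i ≡ false) → sum f ≡ false
sum-zero {m} f≗0 = trans (sum-cong-≗ f≗0) (sum-replicate-zero m)

sum-single : ∀ {m} {f : Fin m → Bool} i → (∀ j → j ≢ i → f j ≡ false) → sum f ≡ f i
sum-single {suc m} {f} i off = begin
  sum f
    ≡⟨ sum-remove {i = i} f ⟩
  f i xor sum (λ j → f (punchIn i j))
    ≡⟨ cong (f i xor_) (sum-zero (λ j → off (punchIn i j) (punchInᵢ≢i i j))) ⟩
  f i xor false
    ≡⟨ xor-identityʳ (f i) ⟩
  f i ∎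
  where open ≡-Reasoning

sum-nonzero : ∀ {m} (f : Fin m → Bool) → sum f ≡ true → ∃ λ i → f i ≡ true
sum-nonzero {suc m} f p with xor-true⁻ (f zero) p
... | inj₁ f0 = zero , f0
... | inj₂ rest with sum-nonzero (f ∘ suc) rest
...   | i , fi = suc i , fi

tagSum : (Tag → Bool) → Bool
tagSum g = g φ xor (g χ xor g ψ)

tagSum-cong : ∀ {g h} → g ≗ h → tagSum g ≡ tagSum h
tagSum-cong g≗h = cong₂ _xor_ (g≗h φ) (cong₂ _xor_ (g≗h χ) (g≗h ψ))

tagSum-distrib-xor : ∀ g h → tagSum (λ a → g a xor h a) ≡ tagSum g xor tagSum h
tagSum-distrib-xor g h = trans (cong ((g φ xor h φ) xor_) (xor-interchange (g χ) (h χ) (g ψ) (h ψ)))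
                               (xor-interchange (g φ) (h φ) (g χ xor g ψ) (h χ xor h ψ))

∧-distribˡ-tagSum : ∀ b g → b ∧ tagSum g ≡ tagSum (λ a → b ∧ g a)
∧-distribˡ-tagSum b g =
  trans (∧-distribˡ-xor b (g φ) _) (cong ((b ∧ g φ) xor_) (∧-distribˡ-xor b (g χ) (g ψ)))

tagSum-comm : ∀ (f : Tag → Tag → Bool) → tagSum (λ a → tagSum (f a)) ≡ tagSum (λ b → tagSum (λ a → f a b))
tagSum-comm f = begin
  tagSum (λ a → f a φ xor (f a χ xor f a ψ))
    ≡⟨ tagSum-distrib-xor (λ a → f a φ) (λ a → f a χ xor f a ψ) ⟩
  tagSum (λ a → f a φ) xor tagSum (λ a → f a χ xor f a ψ)
    ≡⟨ cong (tagSum (λ a → f a φ) xor_) (tagSum-distrib-xor (λ a → f a χ) (λ a → f a ψ)) ⟩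
  tagSum (λ a → f a φ) xor (tagSum (λ a → f a χ) xor tagSum (λ a → f a ψ)) ∎
  where open ≡-Reasoning

tagSum-sum : ∀ {m} (g : Tag → Fin m → Bool) → tagSum (λ a → sum (g a)) ≡ sum (λ i → tagSum (λ a → g a i))
tagSum-sum g = sym (trans (∑-distrib-+ (g φ) _) (cong (sum (g φ) xor_) (∑-distrib-+ (g χ) (g ψ))))

tagSum-single : ∀ {g} a → (∀ b → b ≢ a → g b ≡ false) → tagSum g ≡ g a
tagSum-single {g} φ off = trans (cong (g φ xor_) (cong₂ _xor_ (off χ λ ()) (off ψ λ ()))) (xor-identityʳ (g φ))
tagSum-single {g} χ off = trans (cong₂ _xor_ (off φ λ ()) (cong (g χ xor_) (off ψ λ ()))) (xor-identityʳ (g χ))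
tagSum-single {g} ψ off = cong₂ _xor_ (off φ λ ()) (cong (_xor g ψ) (off χ λ ()))

tagSum-nonzero : ∀ g → tagSum g ≡ true → ∃ λ a → g a ≡ true
tagSum-nonzero g p with xor-true⁻ (g φ) p
... | inj₁ gφ = φ , gφ
... | inj₂ q with xor-true⁻ (g χ) q
...   | inj₁ gχ = χ , gχ
...   | inj₂ gψ = ψ , gψ

module _ {n : ℕ} where

  sumW-cong : ∀ {f g : W n → Bool} → f ≗ g → sumW f ≡ sumW g
  sumW-cong f≗g = sum-cong-≗ (λ v → tagSum-cong (λ a → f≗g (v , a)))

  sumW-distrib-xor : ∀ (f g : W n → Bool) → sumW (λ w → f w xor g w) ≡ sumW f xor sumW g
  sumW-distrib-xor f g = trans (sum-cong-≗ (λ v → tagSum-distrib-xor (λ a → f (v , a)) (λ a → g (v , a))))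
                               (∑-distrib-+ (λ v → tagSum (λ a → f (v , a))) (λ v → tagSum (λ a → g (v , a))))

  ∧-distribˡ-sumW : ∀ b (f : W n → Bool) → b ∧ sumW f ≡ sumW (λ w → b ∧ f w)
  ∧-distribˡ-sumW b f = trans (*-distribˡ-sum b (λ v → tagSum (λ a → f (v , a))))
                              (sum-cong-≗ (λ v → ∧-distribˡ-tagSum b (λ a → f (v , a))))

  ∧-distribʳ-sumW : ∀ (f : W n → Bool) b → sumW f ∧ b ≡ sumW (λ w → f w ∧ b)
  ∧-distribʳ-sumW f b =
    trans (∧-comm (sumW f) b) (trans (∧-distribˡ-sumW b f) (sumW-cong (λ w → ∧-comm b (f w))))

  sumW-comm : ∀ (f : W n → W n → Bool) → sumW (λ w → sumW (f w)) ≡ sumW (λ w' → sumW (λ w → f w w'))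
  sumW-comm f = begin
    sum (λ v → tagSum (λ a → sum (λ v' → tagSum (λ b → f (v , a) (v' , b)))))
      ≡⟨ sum-cong-≗ (λ v → tagSum-sum (λ a v' → tagSum (λ b → f (v , a) (v' , b)))) ⟩
    sum (λ v → sum (λ v' → tagSum (λ a → tagSum (λ b → f (v , a) (v' , b)))))
      ≡⟨ ∑-comm (λ v v' → tagSum (λ a → tagSum (λ b → f (v , a) (v' , b)))) ⟩
    sum (λ v' → sum (λ v → tagSum (λ a → tagSum (λ b → f (v , a) (v' , b)))))
      ≡⟨ sum-cong-≗ (λ v' → sum-cong-≗ (λ v → tagSum-comm (λ a b → f (v , a) (v' , b)))) ⟩
    sum (λ v' → sum (λ v → tagSum (λ b → tagSum (λ a → f (v , a) (v' , b)))))
      ≡⟨ sum-cong-≗ (λ v' → sym (tagSum-sum (λ b v → tagSum (λ a → f (v , a) (v' , b))))) ⟩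
    sum (λ v' → tagSum (λ b → sum (λ v → tagSum (λ a → f (v , a) (v' , b))))) ∎
    where open ≡-Reasoning

  sumW-single : ∀ {f : W n → Bool} e → (∀ w → w ≢ e → f w ≡ false) → sumW f ≡ f e
  sumW-single {f} (v , a) off =
    trans (sum-single v (λ u u≢v → tagSum-cong (λ b → off (u , b) (u≢v ∘ cong proj₁))))
          (tagSum-single a (λ b b≢a → off (v , b) (b≢a ∘ cong proj₂)))

  sumW-nonzero : ∀ (f : W n → Bool) → sumW f ≡ true → ∃ λ w → f w ≡ true
  sumW-nonzero f p with sum-nonzero _ p
  ... | v , q with tagSum-nonzero _ q
  ...   | a , r = (v , a) , r

allW : ∀ n → List (W n)
allW n = cartesianProduct (allFin n) (φ ∷ χ ∷ ψ ∷ [])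

∈-allW : ∀ {n} (w : W n) → w ∈ₗ allW n
∈-allW (v , a) = ∈-cartesianProduct⁺ (∈-allFin v) (∈-tags a)
  where
  ∈-tags : ∀ a → a ∈ₗ φ ∷ χ ∷ ψ ∷ []
  ∈-tags φ = here refl
  ∈-tags χ = there (here refl)
  ∈-tags ψ = there (there (here refl))

module Linear {n m : ℕ} (col : W n → Fin m → Bool) where

  private variable
    e : W n
    u : Fin m → Bool
    B B₀ P X Y Z : Subset (W n)

  combination : Subset (W n) → Fin m → Bool
  combination Z i = sumW (λ w → Z w ∧ col w i)

  IsCycle : Subset (W n) → Set
  IsCycle Z = ∀ i → combination Z i ≡ false

  Independent : Subset (W n) → Set
  Independent Y = ∀ Z → Z ⊆ Y → IsCycle Z → ∀ w → w ∉ Z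

  Spans : Subset (W n) → (Fin m → Bool) → Set
  Spans Y u = Σ (Subset (W n)) λ Z → Z ⊆ Y × (∀ i → combination Z i ≡ u i)

  matroid : Matroid (W n)
  matroid = record { ground = λ _ → true ; Ind = Independent }

  combination-⊕ : ∀ Z Z' i → combination (Z ⊕ Z') i ≡ combination Z i xor combination Z' i
  combination-⊕ Z Z' i = trans (sumW-cong (λ w → ∧-distribʳ-xor (col w i) (Z w) (Z' w)))
                               (sumW-distrib-xor (λ w → Z w ∧ col w i) (λ w → Z' w ∧ col w i))

  combination-single : ∀ e i → combination (single _≟W_ e) i ≡ col e i
  combination-single e i =
    trans (sumW-single e (λ w w≢e → cong (_∧ col w i) (∉-single _≟W_ w≢e)))
          (cong (_∧ col e i) (∈-single _≟W_ e))

  ∅-independent : Independent ∅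
  ∅-independent Z Z⊆∅ _ w = ¬∈⇒∉ {X = Z} (λ w∈Z → case Z⊆∅ w w∈Z of λ ())

  span-mono : X ⊆ Y → Spans X u → Spans Y u
  span-mono X⊆Y (Z , Z⊆X , Z↦u) = Z , (λ w → X⊆Y w ∘ Z⊆X w) , Z↦u

  ∈⇒spans : e ∈ Y → Spans Y (col e)
  ∈⇒spans {e} {Y} e∈Y =
    single _≟W_ e , (λ w w∈e → subst (_∈ Y) (sym (∈-single⁻ _≟W_ w∈e)) e∈Y) , combination-single e

  spans⇒cycle : e ∉ P → Spans P (col e) → Σ (Subset (W n)) λ C → C ⊆ insert _≟W_ e P × IsCycle C × e ∈ C
  spans⇒cycle {e} {P} e∉P (Z , Z⊆P , Z↦e) = Z ⊕ single _≟W_ e , C⊆ , cycle , e∈C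
    where
    e∉Z : e ∉ Z
    e∉Z = ¬∈⇒∉ {X = Z} (λ e∈Z → ∈⇒¬∉ {X = P} (Z⊆P e e∈Z) e∉P)
    C⊆ : Z ⊕ single _≟W_ e ⊆ insert _≟W_ e P
    C⊆ w p with ∈-⊕⁻ {X = Z} {Y = single _≟W_ e} p
    ... | inj₁ w∈Z = ∈-insert⁺ˡ _≟W_ {X = P} (Z⊆P w w∈Z)
    ... | inj₂ w∈e = subst (_∈ insert _≟W_ e P) (sym (∈-single⁻ _≟W_ w∈e)) (∈-insert⁺ʳ _≟W_ {X = P})
    cycle : IsCycle (Z ⊕ single _≟W_ e)
    cycle i = trans (combination-⊕ Z (single _≟W_ e) i)
                    (trans (cong₂ _xor_ (Z↦e i) (combination-single e i)) (xor-same (col e i)))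
    e∈C : e ∈ Z ⊕ single _≟W_ e
    e∈C = cong₂ _xor_ e∉Z (∈-single _≟W_ e)

  independent⇒¬spans : Independent Y → e ∈ Y → P ⊆ Y → e ∉ P → ¬ Spans P (col e)
  independent⇒¬spans {Y} {e} {P} indY e∈Y P⊆Y e∉P sp =
    let C , C⊆ , cycle , e∈C = spans⇒cycle e∉P sp
        C⊆Y : C ⊆ Y
        C⊆Y w = insert-⊆ _≟W_ {e = e} {X = P} e∈Y P⊆Y w ∘ C⊆ w
    in ∈⇒¬∉ {X = C} e∈C (indY C C⊆Y cycle e)

  cycle⇒spans : Z ⊆ insert _≟W_ e B → IsCycle Z → e ∈ Z → Spans B (col e)
  cycle⇒spans {Z} {e} {B} Z⊆ cycle e∈Z = Z' , Z'⊆B , Z'↦e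
    where
    Z' : Subset (W n)
    Z' = Z ⊕ single _≟W_ e

    e∉Z' : e ∉ Z'
    e∉Z' = cong₂ _xor_ e∈Z (∈-single _≟W_ e)

    Z'⊆B : Z' ⊆ B
    Z'⊆B x x∈Z' = [ in-B , (λ x∈e → ⊥-elim (x≢e (∈-single⁻ _≟W_ x∈e))) ]′
                    (∈-⊕⁻ {X = Z} {Y = single _≟W_ e} x∈Z')
      where
      x≢e : x ≢ e
      x≢e x≡e = ∈⇒¬∉ {X = Z'} (subst (_∈ Z') x≡e x∈Z') e∉Z'
      in-B : x ∈ Z → x ∈ B
      in-B x∈Z = [ (λ x∈B → x∈B) , ⊥-elim ∘ x≢e ]′ (∈-insert⁻ _≟W_ {X = B} (Z⊆ x x∈Z))

    Z'↦e : ∀ i → combination Z' i ≡ col e i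
    Z'↦e i = trans (combination-⊕ Z (single _≟W_ e) i) (cong₂ _xor_ (cycle i) (combination-single e i))

  insert-independent : Independent B → ¬ Spans B (col e) → Independent (insert _≟W_ e B)
  insert-independent {B} {e} indB ¬sp Z Z⊆ cycle w with e ∈? Z
  ... | yes e∈Z = ⊥-elim (¬sp (cycle⇒spans Z⊆ cycle e∈Z))
  ... | no e∉Z = indB Z Z⊆B cycle w
    where
    Z⊆B : Z ⊆ B
    Z⊆B x x∈Z = [ (λ x∈B → x∈B) , (λ { refl → ⊥-elim (e∉Z x∈Z) }) ]
                  (∈-insert⁻ _≟W_ {X = B} (Z⊆ x x∈Z))

  span-trans : (∀ e → e ∈ X → Spans Y (col e)) → Spans X u → Spans Y u
  span-trans {X} {Y} {u} spans (Z , Z⊆X , Z↦u) = Z' , Z'⊆Y , Z'↦u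
    where
    part : ∀ w → Σ (Subset (W n)) λ Q → Q ⊆ Y × (w ∈ Z → ∀ i → combination Q i ≡ col w i)
    part w with w ∈? Z
    ... | yes w∈Z = let Q , Q⊆Y , Q↦w = spans w (Z⊆X w w∈Z) in Q , Q⊆Y , λ _ → Q↦w
    ... | no w∉Z = ∅ , (λ _ ()) , λ w∈Z → ⊥-elim (w∉Z w∈Z)

    Q : W n → Subset (W n)
    Q w = proj₁ (part w)

    Z' : Subset (W n)
    Z' v = sumW (λ w → Z w ∧ Q w v)

    Z'⊆Y : Z' ⊆ Y
    Z'⊆Y v v∈Z' =
      let w , p = sumW-nonzero (λ w → Z w ∧ Q w v) v∈Z' in proj₁ (proj₂ (part w)) v (proj₂ (∧-true⁻ (Z w) p))

    Z'↦u : ∀ i → combination Z' i ≡ u i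
    Z'↦u i = begin
      sumW (λ v → Z' v ∧ col v i)
        ≡⟨ sumW-cong (λ v → ∧-distribʳ-sumW (λ w → Z w ∧ Q w v) (col v i)) ⟩
      sumW (λ v → sumW (λ w → (Z w ∧ Q w v) ∧ col v i))
        ≡⟨ sumW-comm (λ v w → (Z w ∧ Q w v) ∧ col v i) ⟩
      sumW (λ w → sumW (λ v → (Z w ∧ Q w v) ∧ col v i))
        ≡⟨ sumW-cong (λ w → sumW-cong (λ v → ∧-assoc (Z w) (Q w v) (col v i))) ⟩
      sumW (λ w → sumW (λ v → Z w ∧ (Q w v ∧ col v i)))
        ≡⟨ sumW-cong (λ w → sym (∧-distribˡ-sumW (Z w) (λ v → Q w v ∧ col v i))) ⟩
      sumW (λ w → Z w ∧ combination (Q w) i)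
        ≡⟨ sumW-cong (λ w → ∧-cong-when (Z w) (λ w∈Z → proj₂ (proj₂ (part w)) w∈Z i)) ⟩
      sumW (λ w → Z w ∧ col w i)
        ≡⟨ Z↦u i ⟩
      u i ∎
      where open ≡-Reasoning

  record Extension (B₀ Y : Subset (W n)) (L : List (W n)) (B : Subset (W n)) : Set where
    field
      extends     : B₀ ⊆ B
      within      : ∀ e → e ∈ B → e ∈ B₀ ⊎ e ∈ Y
      independent : Independent B
      spans       : ∀ e → e ∈ₗ L → e ∈ Y → Spans B (col e)

  spans-∷ : ∀ {L B} → Extension B₀ Y L B → (e ∈ Y → Spans B (col e)) → Extension B₀ Y (e ∷ L) B
  spans-∷ ext spans-e = record
    { extends = extends ; within = within ; independent = independent
    ; spans   = λ { _ (here refl) → spans-e ; e' (there e'∈L) → spans e' e'∈L } }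
    where open Extension ext

  extension-of-insert : ∀ {L B} → e ∈ Y → Extension (insert _≟W_ e B₀) Y L B → Extension B₀ Y L B
  extension-of-insert {e} {Y} {B₀} {B = B} e∈Y ext = record
    { extends = λ x → extends x ∘ ∈-insert⁺ˡ _≟W_ {X = B₀}
    ; within = within′ ; independent = independent ; spans = spans }
    where
    open Extension ext
    within′ : ∀ x → x ∈ B → x ∈ B₀ ⊎ x ∈ Y
    within′ x x∈B with within x x∈B
    ... | inj₂ x∈Y = inj₂ x∈Y
    ... | inj₁ x∈B₀+e = [ inj₁ , (λ x≡e → inj₂ (subst (_∈ Y) (sym x≡e) e∈Y)) ]
                          (∈-insert⁻ _≟W_ {X = B₀} x∈B₀+e)

  -- The greedy algorithm; whether each element is already spanned is decided only up to double negation.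
  extend : ∀ L → Independent B₀ → ¬ ¬ Σ (Subset (W n)) (Extension B₀ Y L)
  extend {B₀} [] ind =
    pure (B₀ , record { extends = λ _ p → p ; within = λ _ → inj₁ ; independent = ind ; spans = λ _ () })
  extend {B₀} {Y} (e ∷ L) ind with e ∈? Y
  ... | no e∉Y = (λ (B , ext) → B , spans-∷ ext (⊥-elim ∘ e∉Y)) <$> extend L ind
  ... | yes e∈Y = ¬¬-excluded-middle >>= λ where
      (yes sp) → (λ (B , ext) → B , spans-∷ ext (λ _ → span-mono (Extension.extends ext) sp)) <$> extend L ind
      (no ¬sp) → (λ (B , ext) → B , spans-∷ (extension-of-insert e∈Y ext)
                                             (λ _ → ∈⇒spans (Extension.extends ext e (∈-insert⁺ʳ _≟W_ {X = B₀}))))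
                 <$> extend L (insert-independent ind ¬sp)

  extension-of-∅ : ∀ {L B} → Extension ∅ Y L B → B ⊆ Y
  extension-of-∅ ext e e∈B = [ (λ ()) , (λ e∈Y → e∈Y) ]′ (Extension.within ext e e∈B)

  spanning⇒basis : ∀ {T} → B ⊆ T → Independent B → (∀ e → e ∈ T → e ∉ B → Spans B (col e))
                 → IsBasis _≟W_ (matroid ∣ T) B
  spanning⇒basis {B} B⊆T indB spans = B⊆T , (B⊆T , indB) , λ e e∈T e∉B (_ , ind+e) →
    independent⇒¬spans ind+e (∈-insert⁺ʳ _≟W_ {X = B}) (λ _ → ∈-insert⁺ˡ _≟W_ {X = B}) e∉B (spans e e∈T e∉B)

  basis-spans : ∀ {T} → IsBasis _≟W_ (matroid ∣ T) B → e ∈ T → e ∉ B → ¬ ¬ Spans B (col e)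
  basis-spans {B} {e} (B⊆T , (_ , indB) , maximal) e∈T e∉B ¬sp =
    maximal e e∈T e∉B (insert-⊆ _≟W_ {e = e} {X = B} e∈T B⊆T , insert-independent indB ¬sp)

  -- B₀ spans T ∖ F ∖ y, and B extends the independent set B₀ + y to a basis of M|T.
  module DualClosure {T F : Subset (W n)} {y : W n} (F⊆T : F ⊆ T) (y∈T : y ∈ T) (y∉F : y ∉ F)
    {B₀ B : Subset (W n)} (ext₀ : Extension ∅ (T ∖ F ∖ single _≟W_ y) (allW n) B₀)
    (ext : Extension (insert _≟W_ y B₀) F (allW n) B) where

    D : Subset (W n)
    D = T ∖ F ∖ single _≟W_ y

    B₀⊆D : B₀ ⊆ D
    B₀⊆D = extension-of-∅ ext₀

    D⊆T : D ⊆ T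
    D⊆T e e∈D = proj₁ (∈-∖⁻ {X = T} {Y = F} (proj₁ (∈-∖⁻ {X = T ∖ F} {Y = single _≟W_ y} e∈D)))

    y∉D : y ∉ D
    y∉D = ∉-∖-single _≟W_ {X = T ∖ F}

    y∈B : y ∈ B
    y∈B = Extension.extends ext y (∈-insert⁺ʳ _≟W_ {X = B₀})

    classify : ∀ e → e ∈ T → e ∈ F ⊎ e ≡ y ⊎ e ∈ D
    classify e e∈T = case (e ∈? F , e ≟W y) of λ where
      (yes e∈F , _)       → inj₁ e∈F
      (no _    , yes e≡y) → inj₂ (inj₁ e≡y)
      (no e∉F  , no e≢y)  → inj₂ (inj₂ (∈-∖⁺ {X = T ∖ F} {Y = single _≟W_ y}
                                         (∈-∖⁺ {X = T} {Y = F} e∈T (¬∈⇒∉ {X = F} e∉F)) (∉-single _≟W_ e≢y)))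

    B⊆T : B ⊆ T
    B⊆T e e∈B = [ insert-⊆ _≟W_ {X = B₀} y∈T (λ w → D⊆T w ∘ B₀⊆D w) e , F⊆T e ]′ (Extension.within ext e e∈B)

    B₀⊆B∖y : B₀ ⊆ B ∖ single _≟W_ y
    B₀⊆B∖y e e∈B₀ = ∈-∖⁺ {X = B} {Y = single _≟W_ y}
                      (Extension.extends ext e (∈-insert⁺ˡ _≟W_ {X = B₀} e∈B₀)) (∉-single _≟W_ e≢y)
      where
      e≢y : e ≢ y
      e≢y refl = ∈⇒¬∉ {X = D} (B₀⊆D e e∈B₀) y∉D

    B-basis : IsBasis _≟W_ (matroid ∣ T) B
    B-basis = spanning⇒basis B⊆T (Extension.independent ext) λ e e∈T e∉B → case classify e e∈T of λ where
      (inj₁ e∈F)        → Extension.spans ext e (∈-allW e) e∈F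
      (inj₂ (inj₁ refl)) → ⊥-elim (∈⇒¬∉ {X = B} y∈B e∉B)
      (inj₂ (inj₂ e∈D)) → span-mono (λ x → proj₁ ∘ ∈-∖⁻ {X = B} {Y = single _≟W_ y} ∘ B₀⊆B∖y x)
                                    (Extension.spans ext₀ e (∈-allW e) e∈D)

    J : Subset (W n)
    J = F ∖ B

    J-coindependent : Ind (dual _≟W_ (matroid ∣ T)) J
    J-coindependent =
      (λ e → F⊆T e ∘ proj₁ ∘ ∈-∖⁻ {X = F} {Y = B}) , B , B-basis , λ e → proj₂ ∘ ∈-∖⁻ {X = F} {Y = B}

    -- Every basis avoiding J + y spans y using B - y only, which contradicts the independence of B.
    J+y-codependent : ¬ Ind (dual _≟W_ (matroid ∣ T)) (insert _≟W_ y J)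
    J+y-codependent (_ , B' , B'-basis , avoids) =
      basis-spans B'-basis y∈T (avoids y (∈-insert⁺ʳ _≟W_ {X = J})) λ B'↦y →
        independent⇒¬spans (Extension.independent ext) y∈B (λ e → proj₁ ∘ ∈-∖⁻ {X = B} {Y = single _≟W_ y})
                            (∉-∖-single _≟W_ {X = B}) (span-trans B'⊆span B'↦y)
      where
      B'⊆span : ∀ e → e ∈ B' → Spans (B ∖ single _≟W_ y) (col e)
      B'⊆span e e∈B' = by-kind (classify e (proj₁ B'-basis e e∈B'))
        where
        e∉J : e ∉ J
        e∉J = ¬∈⇒∉ {X = J} (λ e∈J → ∈⇒¬∉ {X = B'} e∈B' (avoids e (∈-insert⁺ˡ _≟W_ {X = J} e∈J)))
        e≢y : e ≢ y
        e≢y refl = ∈⇒¬∉ {X = B'} e∈B' (avoids y (∈-insert⁺ʳ _≟W_ {X = J}))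
        by-kind : e ∈ F ⊎ e ≡ y ⊎ e ∈ D → Spans (B ∖ single _≟W_ y) (col e)
        by-kind (inj₁ e∈F)        =
          ∈⇒spans (∈-∖⁺ {X = B} {Y = single _≟W_ y} (∉-∖⁻ {X = F} {Y = B} e∈F e∉J) (∉-single _≟W_ e≢y))
        by-kind (inj₂ (inj₁ e≡y)) = ⊥-elim (e≢y e≡y)
        by-kind (inj₂ (inj₂ e∈D)) = span-mono B₀⊆B∖y (Extension.spans ext₀ e (∈-allW e) e∈D)

    y∈closure : InClosure _≟W_ (dual _≟W_ (matroid ∣ T)) F y
    y∈closure = inj₂ (J , (λ e → proj₁ ∘ ∈-∖⁻ {X = F} {Y = B}) , J-coindependent , J+y-codependent)

  dual-closure : ∀ {T F y} → F ⊆ T → y ∈ T → y ∉ F → ¬ Spans (T ∖ F ∖ single _≟W_ y) (col y)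
               → ¬ ¬ InClosure _≟W_ (dual _≟W_ (matroid ∣ T)) F y
  dual-closure {T} {F} {y} F⊆T y∈T y∉F ¬sp = do
    B₀ , ext₀ ← extend {Y = T ∖ F ∖ single _≟W_ y} (allW n) ∅-independent
    B  , ext  ← extend {Y = F} (allW n)
                  (insert-independent (Extension.independent ext₀) (¬sp ∘ span-mono (extension-of-∅ ext₀)))
    pure (DualClosure.y∈closure F⊆T y∈T y∉F ext₀ ext)

-- The column of v_c is a e_v + b A e_v for (a , b) = tagVector c; accordingly coords z collects the
-- coefficients of a subset z of {v_φ, v_χ, v_ψ} on e_v and on A e_v.
tagVector : Tag → Bool × Bool
tagVector φ = true  , false
tagVector χ = false , true
tagVector ψ = true  , true

scale : Bool → Bool × Bool → Bool × Bool
scale p (a , b) = a ∧ p , b ∧ p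

coords : (Tag → Bool) → Bool × Bool
coords z = z φ xor z ψ , z χ xor z ψ

ω : Bool × Bool → Bool × Bool → Bool
ω (a , b) (a' , b') = (b' ∧ a) xor (b ∧ a')

ω-scale : ∀ p q u v → ω (scale p u) (scale q v) ≡ (p ∧ q) ∧ ω u v
ω-scale p q (a , b) (a' , b') = expand p q a b a' b'
  where
  expand : ∀ p q a b a' b'
         → ((b' ∧ q) ∧ (a ∧ p)) xor ((b ∧ p) ∧ (a' ∧ q)) ≡ (p ∧ q) ∧ ((b' ∧ a) xor (b ∧ a'))
  expand = solve-∀ GF₂

ω-tagVector : ∀ {s t} → s ≢ t → ω (tagVector s) (tagVector t) ≡ true
ω-tagVector {φ} {χ} _ = refl
ω-tagVector {φ} {ψ} _ = refl
ω-tagVector {χ} {φ} _ = refl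
ω-tagVector {χ} {ψ} _ = refl
ω-tagVector {ψ} {φ} _ = refl
ω-tagVector {ψ} {χ} _ = refl
ω-tagVector {φ} {φ} s≢t = ⊥-elim (s≢t refl)
ω-tagVector {χ} {χ} s≢t = ⊥-elim (s≢t refl)
ω-tagVector {ψ} {ψ} s≢t = ⊥-elim (s≢t refl)

SupportedAt : Tag → (Tag → Bool) → Set
SupportedAt s z = ∀ c → c ≢ s → z c ≡ false

coords-supported : ∀ s {z} → SupportedAt s z → coords z ≡ scale (z s) (tagVector s)
coords-supported φ {z} off =
  cong₂ _,_ (trans (cong (z φ xor_) (off ψ λ ())) (xor-identityʳ (z φ))) (cong₂ _xor_ (off χ λ ()) (off ψ λ ()))
coords-supported χ {z} off =
  cong₂ _,_ (cong₂ _xor_ (off φ λ ()) (off ψ λ ())) (trans (cong (z χ xor_) (off ψ λ ())) (xor-identityʳ (z χ)))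
coords-supported ψ {z} off =
  cong₂ _,_ (cong (_xor z ψ) (off φ λ ())) (cong (_xor z ψ) (off χ λ ()))

-- The tag vectors are the three nonzero vectors of GF(2)², any two distinct ones having product 1.
ω-supported : ∀ {s t z z'} → s ≢ t → SupportedAt s z → SupportedAt t z'
            → ω (coords z) (coords z') ≡ z s ∧ z' t
ω-supported {s} {t} {z} {z'} s≢t off off' = begin
  ω (coords z) (coords z')
    ≡⟨ cong₂ ω (coords-supported s off) (coords-supported t off') ⟩
  ω (scale (z s) (tagVector s)) (scale (z' t) (tagVector t)) ≡⟨ ω-scale (z s) (z' t) (tagVector s) (tagVector t) ⟩
  (z s ∧ z' t) ∧ ω (tagVector s) (tagVector t)
    ≡⟨ cong ((z s ∧ z' t) ∧_) (ω-tagVector s≢t) ⟩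
  (z s ∧ z' t) ∧ true
    ≡⟨ ∧-identityʳ (z s ∧ z' t) ⟩
  z s ∧ z' t ∎
  where open ≡-Reasoning

fibre : ∀ {n} → Subset (W n) → Fin n → Tag → Bool
fibre Z v c = Z (v , c)

module IAS {n : ℕ} (G : LoopedSimpleGraph n) where

  open Linear (column G)

  idPart adjPart : Subset (W n) → Fin n → Bool
  idPart  Z v = proj₁ (coords (fibre Z v))
  adjPart Z v = proj₂ (coords (fibre Z v))

  A· : (Fin n → Bool) → Fin n → Bool
  A· x i = sum (λ u → adj G i u ∧ x u)

  combination-decomposes : ∀ Z i → combination Z i ≡ idPart Z i xor A· (adjPart Z) i
  combination-decomposes Z i = begin
    sum (λ u → tagSum (λ c → Z (u , c) ∧ column G (u , c) i))
      ≡⟨ sum-cong-≗ (λ u → regroup (Z (u , φ)) (Z (u , χ)) (Z (u , ψ)) (δ i u) (adj G i u)) ⟩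
    sum (λ u → (idPart Z u ∧ δ i u) xor (adj G i u ∧ adjPart Z u))
      ≡⟨ ∑-distrib-+ (λ u → idPart Z u ∧ δ i u) (λ u → adj G i u ∧ adjPart Z u) ⟩
    sum (λ u → idPart Z u ∧ δ i u) xor A· (adjPart Z) i
      ≡⟨ cong (_xor A· (adjPart Z) i) (sum-single i off-diagonal) ⟩
    (idPart Z i ∧ δ i i) xor A· (adjPart Z) i
      ≡⟨ cong (λ d → (idPart Z i ∧ d) xor A· (adjPart Z) i) (∈-single _≟ᶠ_ i) ⟩
    (idPart Z i ∧ true) xor A· (adjPart Z) i
      ≡⟨ cong (_xor A· (adjPart Z) i) (∧-identityʳ (idPart Z i)) ⟩
    idPart Z i xor A· (adjPart Z) i ∎
    where
    open ≡-Reasoning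
    regroup : ∀ p q r d x → (p ∧ d) xor ((q ∧ x) xor (r ∧ (d xor x))) ≡ ((p xor r) ∧ d) xor (x ∧ (q xor r))
    regroup = solve-∀ GF₂
    off-diagonal : ∀ u → u ≢ i → idPart Z u ∧ δ i u ≡ false
    off-diagonal u u≢i = trans (cong (idPart Z u ∧_) (∉-single _≟ᶠ_ (u≢i ∘ sym))) (∧-zeroʳ (idPart Z u))

  cycle-balance : ∀ {Z} → IsCycle Z → ∀ i → idPart Z i ≡ A· (adjPart Z) i
  cycle-balance {Z} cycle i = xor-false⇒≡ _ _ (trans (sym (combination-decomposes Z i)) (cycle i))

  A·-symmetric : ∀ x y → sum (λ i → x i ∧ A· y i) ≡ sum (λ i → y i ∧ A· x i)
  A·-symmetric x y = begin
    sum (λ i → x i ∧ A· y i)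
      ≡⟨ sum-cong-≗ (λ i → *-distribˡ-sum (x i) (λ u → adj G i u ∧ y u)) ⟩
    sum (λ i → sum (λ u → x i ∧ (adj G i u ∧ y u)))
      ≡⟨ ∑-comm (λ i u → x i ∧ (adj G i u ∧ y u)) ⟩
    sum (λ u → sum (λ i → x i ∧ (adj G i u ∧ y u)))
      ≡⟨ sum-cong-≗ (λ u → sum-cong-≗ (λ i → transpose i u)) ⟩
    sum (λ u → sum (λ i → y u ∧ (adj G u i ∧ x i)))
      ≡⟨ sum-cong-≗ (λ u → sym (*-distribˡ-sum (y u) (λ i → adj G u i ∧ x i))) ⟩
    sum (λ u → y u ∧ A· x u) ∎
    where
    open ≡-Reasoning
    rearrange : ∀ a b c → a ∧ (c ∧ b) ≡ b ∧ (c ∧ a)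
    rearrange = solve-∀ GF₂
    transpose : ∀ i u → x i ∧ (adj G i u ∧ y u) ≡ y u ∧ (adj G u i ∧ x i)
    transpose i u = trans (rearrange (x i) (y u) (adj G i u)) (cong (λ c → y u ∧ (c ∧ x i)) (symm G i u))

  pairing : Subset (W n) → Subset (W n) → Fin n → Bool
  pairing Z Z' v = ω (coords (fibre Z v)) (coords (fibre Z' v))

  cycles-orthogonal : ∀ {Z Z'} → IsCycle Z → IsCycle Z' → sum (pairing Z Z') ≡ false
  cycles-orthogonal {Z} {Z'} cycle cycle' = begin
    sum (λ v → (b' v ∧ idPart Z v) xor (b v ∧ idPart Z' v))
      ≡⟨ ∑-distrib-+ (λ v → b' v ∧ idPart Z v) (λ v → b v ∧ idPart Z' v) ⟩
    sum (λ v → b' v ∧ idPart Z v) xor sum (λ v → b v ∧ idPart Z' v)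
      ≡⟨ cong₂ _xor_ (sum-cong-≗ (λ v → cong (b' v ∧_) (cycle-balance {Z} cycle v)))
                     (sum-cong-≗ (λ v → cong (b v ∧_) (cycle-balance {Z'} cycle' v))) ⟩
    sum (λ v → b' v ∧ A· b v) xor sum (λ v → b v ∧ A· b' v)
      ≡⟨ cong (_xor sum (λ v → b v ∧ A· b' v)) (A·-symmetric b' b) ⟩
    sum (λ v → b v ∧ A· b' v) xor sum (λ v → b v ∧ A· b' v)
      ≡⟨ xor-same (sum (λ v → b v ∧ A· b' v)) ⟩
    false ∎
    where
    open ≡-Reasoning
    b b' : Fin n → Bool
    b  = adjPart Z
    b' = adjPart Z'

module Transversal {n : ℕ} {X : Subset (W n)} (tX : IsTransversal X) where

  tag : Fin n → Tag
  tag v = proj₁ (tX v)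

  tag-∈ : ∀ v → (v , tag v) ∈ X
  tag-∈ v = proj₁ (proj₂ (tX v))

  tag-unique : ∀ {v a} → (v , a) ∈ X → a ≡ tag v
  tag-unique {v} {a} = proj₂ (proj₂ (tX v)) a

  ⊆-supported : ∀ {Z} → Z ⊆ X → ∀ v → SupportedAt (tag v) (fibre Z v)
  ⊆-supported {Z} Z⊆X v c c≢tag = ¬∈⇒∉ {X = Z} (λ vc∈Z → c≢tag (tag-unique (Z⊆X (v , c) vc∈Z)))

open Transversal using (tag; tag-∈; tag-unique; ⊆-supported)

tags-differ : ∀ {n} {S T : Subset (W n)} (tS : IsTransversal S) (tT : IsTransversal T) → Disjoint S T
            → ∀ v → tag tS v ≢ tag tT v
tags-differ {T = T} tS tT disj v eq =
  ∈⇒¬∉ {X = T} (subst (λ a → (v , a) ∈ T) (sym eq) (tag-∈ tT v)) (disj _ (tag-∈ tS v))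

anyTag : (Tag → Bool) → Bool
anyTag g = g φ ∨ (g χ ∨ g ψ)

anyTag⁺ : ∀ {g} a → g a ≡ true → anyTag g ≡ true
anyTag⁺ {g} φ p = cong (_∨ (g χ ∨ g ψ)) p
anyTag⁺ {g} χ p = trans (cong (λ b → g φ ∨ (b ∨ g ψ)) p) (∨-zeroʳ (g φ))
anyTag⁺ {g} ψ p =
  trans (cong (λ b → g φ ∨ (g χ ∨ b)) p) (trans (cong (g φ ∨_) (∨-zeroʳ (g χ))) (∨-zeroʳ (g φ)))

anyTag⁻ : ∀ g → anyTag g ≡ true → ∃ λ a → g a ≡ true
anyTag⁻ g p with ∨-true⁻ (g φ) p
... | inj₁ gφ = φ , gφ
... | inj₂ q with ∨-true⁻ (g χ) q
...   | inj₁ gχ = χ , gχ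
...   | inj₂ gψ = ψ , gψ

module _ {n : ℕ} {S T F : Subset (W n)} (tT : IsTransversal T) where

  ∈-preimageST⁻ : ∀ {v a} → (v , a) ∈ preimageST S T F → (v , a) ∈ S × (v , tag tT v) ∈ F
  ∈-preimageST⁻ {v} {a} p =
    let v,a∈S , some = ∧-true⁻ (S (v , a)) p
        d , v,d∈T∩F = anyTag⁻ (λ d → T (v , d) ∧ F (v , d)) some
        v,d∈T , v,d∈F = ∧-true⁻ (T (v , d)) v,d∈T∩F
    in v,a∈S , subst (λ d → (v , d) ∈ F) (tag-unique tT v,d∈T) v,d∈F

  ∈-preimageST⁺ : ∀ {v a} → (v , a) ∈ S → (v , tag tT v) ∈ F → (v , a) ∈ preimageST S T F
  ∈-preimageST⁺ {v} v,a∈S y∈F =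
    cong₂ _∧_ v,a∈S (anyTag⁺ {g = λ d → T (v , d) ∧ F (v , d)} (tag tT v) (cong₂ _∧_ (tag-∈ tT v) y∈F))

  crossings-only-at : ∀ {I C C' v a} (tS : IsTransversal S) → I ⊆ preimageST S T F
                    → C ⊆ insert _≟W_ (v , a) I → Disjoint C' F
                    → ∀ u → u ≢ v → C (u , tag tS u) ∧ C' (u , tag tT u) ≡ false
  crossings-only-at {I} {C} {C'} tS I⊆pre C⊆ C'∩F=∅ u u≢v = by-membership ((u , tag tS u) ∈? C)
    where
    partner-∈-F : (u , tag tS u) ∈ C → (u , tag tT u) ∈ F
    partner-∈-F ∈C = [ (λ ∈I → proj₂ (∈-preimageST⁻ (I⊆pre _ ∈I))) , ⊥-elim ∘ u≢v ∘ cong proj₁ ]′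
                       (∈-insert⁻ _≟W_ {X = I} (C⊆ _ ∈C))
    by-membership : Dec ((u , tag tS u) ∈ C) → C (u , tag tS u) ∧ C' (u , tag tT u) ≡ false
    by-membership (no ∉C)  = cong (_∧ C' (u , tag tT u)) (¬∈⇒∉ {X = C} ∉C)
    by-membership (yes ∈C) =
      trans (cong (C (u , tag tS u) ∧_) (¬∈⇒∉ {X = C'} λ ∈C' → ∈⇒¬∉ {X = F} (partner-∈-F ∈C) (C'∩F=∅ _ ∈C')))
            (∧-zeroʳ (C (u , tag tS u)))

module _ {n : ℕ} (G : LoopedSimpleGraph n) where

  open Linear (column G)
  open IAS G

  crossings-even : ∀ {S T Z Z'} (tS : IsTransversal S) (tT : IsTransversal T) → Disjoint S T
                 → Z ⊆ S → Z' ⊆ T → IsCycle Z → IsCycle Z'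
                 → sum (λ v → Z (v , tag tS v) ∧ Z' (v , tag tT v)) ≡ false
  crossings-even {Z = Z} {Z'} tS tT disj Z⊆S Z'⊆T cycle cycle' =
    trans (sum-cong-≗ λ v → sym (ω-supported (tags-differ tS tT disj v) (⊆-supported tS Z⊆S v) (⊆-supported tT Z'⊆T v)))
          (cycles-orthogonal {Z} {Z'} cycle cycle')

  single-crossing-impossible : ∀ {S T Z Z'} (tS : IsTransversal S) (tT : IsTransversal T) → Disjoint S T
                             → Z ⊆ S → Z' ⊆ T → IsCycle Z → IsCycle Z'
                             → ∀ v → (v , tag tS v) ∈ Z → (v , tag tT v) ∈ Z'
                             → ¬ (∀ u → u ≢ v → Z (u , tag tS u) ∧ Z' (u , tag tT u) ≡ false)
  single-crossing-impossible {Z = Z} {Z'} tS tT disj Z⊆S Z'⊆T cycle cycle' v ∈Z ∈Z' elsewhere =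
    case trans (sym (crossings-even tS tT disj Z⊆S Z'⊆T cycle cycle'))
               (trans (sum-single v elsewhere) (cong₂ _∧_ ∈Z ∈Z')) of λ ()

  partner-∈-flat : ∀ {S T F I v a} (tS : IsTransversal S) (tT : IsTransversal T) → Disjoint S T
                 → Flat _≟W_ (dual _≟W_ (MIAS G ∣ T)) F
                 → (v , a) ∈ S → I ⊆ preimageST S T F → Independent I → ¬ Independent (insert _≟W_ (v , a) I)
                 → (v , tag tT v) ∈ F
  partner-∈-flat {S} {T} {F} {I} {v} {a} tS tT disj (F⊆T , F-closed) x∈S I⊆pre indI dependent
    with (v , tag tT v) ∈? F
  ... | yes y∈F = y∈F
  ... | no y∉F = ⊥-elim (x-spanned λ Sx → y-spanned λ Sy → odd-crossing Sx Sy)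
    where
    x y : W n
    x = v , a
    y = v , tag tT v

    D : Subset (W n)
    D = T ∖ F ∖ single _≟W_ y

    x-spanned : ¬ ¬ Spans I (column G x)
    x-spanned ¬sp = dependent (insert-independent indI ¬sp)

    y-spanned : ¬ ¬ Spans D (column G y)
    y-spanned ¬sp = dual-closure F⊆T (tag-∈ tT v) (¬∈⇒∉ {X = F} y∉F) ¬sp (y∉F ∘ F-closed y (tag-∈ tT v))

    x∉I : x ∉ I
    x∉I = ¬∈⇒∉ {X = I} (λ x∈I → y∉F (proj₂ (∈-preimageST⁻ {S = S} {F = F} tT (I⊆pre x x∈I))))

    I+x⊆S : insert _≟W_ x I ⊆ S
    I+x⊆S = insert-⊆ _≟W_ {X = I} x∈S (λ w → proj₁ ∘ ∈-preimageST⁻ {S = S} {F = F} tT ∘ I⊆pre w)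

    D+y⊆T : insert _≟W_ y D ⊆ T
    D+y⊆T = insert-⊆ _≟W_ {X = D} (tag-∈ tT v)
              (λ w → proj₁ ∘ ∈-∖⁻ {X = T} {Y = F} ∘ proj₁ ∘ ∈-∖⁻ {X = T ∖ F} {Y = single _≟W_ y})

    D+y∩F=∅ : Disjoint (insert _≟W_ y D) F
    D+y∩F=∅ w w∈D+y = [ proj₂ ∘ ∈-∖⁻ {X = T} {Y = F} ∘ proj₁ ∘ ∈-∖⁻ {X = T ∖ F} {Y = single _≟W_ y}
                      , (λ w≡y → subst (_∉ F) (sym w≡y) (¬∈⇒∉ {X = F} y∉F)) ]′
                      (∈-insert⁻ _≟W_ {X = D} w∈D+y)

    odd-crossing : Spans I (column G x) → Spans D (column G y) → ⊥
    odd-crossing Sx Sy =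
      let C  , C⊆  , cycle  , x∈C  = spans⇒cycle x∉I Sx
          C' , C'⊆ , cycle' , y∈C' = spans⇒cycle (∉-∖-single _≟W_ {X = T ∖ F}) Sy
      in single-crossing-impossible tS tT disj (λ w → I+x⊆S w ∘ C⊆ w) (λ w → D+y⊆T w ∘ C'⊆ w)
           cycle cycle' v
           (subst (λ c → (v , c) ∈ C) (tag-unique tS x∈S) x∈C) y∈C'
           (crossings-only-at tT tS I⊆pre C⊆ (λ w → D+y∩F=∅ w ∘ C'⊆ w))

corollary43 : (n : ℕ) (G : LoopedSimpleGraph n) (S T : Subset (W n))
    → IsTransversal S → IsTransversal T → Disjoint S T
    → ∀ (F : Subset (W n))
    → Flat _≟W_ (dual _≟W_ (MIAS G ∣ T)) F
    → Flat _≟W_ (MIAS G ∣ S) (preimageST S T F)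
corollary43 n G S T tS tT disj F F-flat = preimage⊆S , preimage-closed
  where
  preimage⊆S : preimageST S T F ⊆ S
  preimage⊆S (v , a) = proj₁ ∘ ∈-preimageST⁻ {S = S} {F = F} tT

  preimage-closed : ∀ x → x ∈ S → InClosure _≟W_ (MIAS G ∣ S) (preimageST S T F) x → x ∈ preimageST S T F
  preimage-closed x _ (inj₁ x∈preimage) = x∈preimage
  preimage-closed (v , a) x∈S (inj₂ (I , I⊆preimage , (I⊆S , indI) , ¬ind)) =
    ∈-preimageST⁺ {S = S} {F = F} tT x∈S
      (partner-∈-flat G tS tT disj F-flat x∈S I⊆preimage indI
        λ ind → ¬ind (insert-⊆ _≟W_ {X = I} x∈S I⊆S , ind))
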